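{- Let $B_n$ be the total number of 1-ascents, summed over all prefixes of dispersed Dyck paths of length $n$ (paths with arbitrary final height). Then \[ \sum_{n\ge0}B_nz^n=\frac{z(1-z)^2}{(1-2z)^2}=z+\sum_{n\ge2}(n+2)2^{n-3}z^n . \]
   Context: A prefix of a dispersed Dyck path of length $n$ is a sequence of $n$ steps, each an up-step $U=(1,1)$, a down-step $D=(1,-1)$, or a flat step $H=(1,0)$, starting at $(0,0)$, never going below the $x$-axis, such that flat steps occur only on the $x$-axis (from $(k,0)$ to $(k+1,0)$); the endpoint may be at any height $\ge0$. An ascent is a maximal run of consecutive $U$ steps (a run at the end of the path also counts); a 1-ascent is an ascent consisting of exactly one $U$ step. -}

module Defs where

open import Data.Nat using (ℕ; zero; suc; _+_)
open import Data.Bool using (Bool; true; false)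
open import Data.List using (List; []; _∷_; map; concatMap)
open import Data.Nat.ListAction using (sum)
open import Data.Integer as ℤ using (ℤ)

-- Steps: U = (1,1), D = (1,-1), H = (1,0)
data Step : Set where
  U D H : Step

words : ℕ → List (List Step)
words zero    = [] ∷ []
words (suc n) = concatMap (λ w → (U ∷ w) ∷ (D ∷ w) ∷ (H ∷ w) ∷ []) (words n)

-- validity of a prefix of a dispersed Dyck path, starting at the given height:
-- never below the x-axis, flat steps only on the x-axis; endpoint arbitrary.
validFrom : ℕ → List Step → Bool
validFrom h       []       = true
validFrom h       (U ∷ w)  = validFrom (suc h) w
validFrom zero    (D ∷ w)  = false
validFrom (suc h) (D ∷ w)  = validFrom h w
validFrom zero    (H ∷ w)  = validFrom zero w
validFrom (suc h) (H ∷ w)  = false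

valid : List Step → Bool
valid = validFrom zero

prefixes : ℕ → List (List Step)
prefixes n = Data.List.filterᵇ valid (words n)

isU : Step → Bool
isU U = true
isU D = false
isU H = false

-- number of 1-ascents (maximal runs of U of length exactly 1),
-- scanning with a flag saying whether the previous step was U
oneAscFrom : Bool → List Step → ℕ
oneAscFrom prevU []            = 0
oneAscFrom true  (U ∷ w)       = oneAscFrom true w
oneAscFrom false (U ∷ [])      = 1
oneAscFrom false (U ∷ U ∷ w)   = oneAscFrom true (U ∷ w)
oneAscFrom false (U ∷ D ∷ w)   = suc (oneAscFrom false (D ∷ w))
oneAscFrom false (U ∷ H ∷ w)   = suc (oneAscFrom false (H ∷ w))
oneAscFrom prevU (D ∷ w)       = oneAscFrom false w
oneAscFrom prevU (H ∷ w)       = oneAscFrom false w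

oneAscents : List Step → ℕ
oneAscents = oneAscFrom false

B : ℕ → ℕ
B n = sum (map oneAscents (prefixes n))

Series : Set
Series = ℕ → ℤ

sumTo : ℕ → (ℕ → ℤ) → ℤ
sumTo zero    f = ℤ.+ 0
sumTo (suc n) f = sumTo n f ℤ.+ f n

_⊛_ : Series → Series → Series
(f ⊛ g) n = sumTo (suc n) (λ k → f k ℤ.* g (n Data.Nat.∸ k))

-- polynomial (finite coefficient list, constant term first) as a series
poly : List ℤ → Series
poly []       n       = ℤ.+ 0
poly (a ∷ as) zero    = a
poly (a ∷ as) (suc n) = poly as n

genB : Series
genB n = ℤ.+ (B n)

{-# OPTIONS --safe #-}
-- At every height exactly two steps are allowed: U, and H on the axis or D above it.  So the
-- prefixes of length n from any height correspond to the 2^n words over {U, non-U}, and the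
-- number of 1-ascents only sees that two-letter word.  Hence the total number of 1-ascents
-- still to be completed, given the length of the current run of U's (0, 1 or at least 2),
-- does not depend on the starting height and satisfies a linear recursion in n; solving it
-- gives 8 B(n) = (n + 2) 2^n for n ≥ 2, and so B(n + 2) - 4 B(n + 1) + 4 B(n) = 0 for n ≥ 2,
-- which is the coefficientwise form of (1 - 2z)^2 Σ B(n) z^n = z (1 - z)^2.
module Submission where

open import Defs
open import Data.Bool using (Bool; true; false; if_then_else_)
open import Data.Integer as ℤ using (+_; -[1+_])
open import Data.Integer.Properties as ℤ using (pos-+; pos-*; i≡j⇒i-j≡0)
import Data.Integer.Tactic.RingSolver as ℤ-Solver
open import Data.List using (List; []; _∷_; _++_; map; filterᵇ; concatMap)
open import Data.List.Properties using (map-++; map-cong)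
open import Data.Nat using (ℕ; zero; suc; pred; _+_; _*_; _^_; _≤_; z≤n; s≤s)
open import Data.Nat.ListAction using (sum)
open import Data.Nat.ListAction.Properties using (sum-++)
open import Data.Nat.Properties using (+-identityʳ; *-identityʳ; *-assoc; +-suc; m≤m+n; *-cancelˡ-≡)
open import Data.Nat.Tactic.RingSolver using (solve-∀)
open import Data.Product using (_×_; _,_)
open import Function using (_∘_)
open import Relation.Binary.PropositionalEquality using (_≡_; refl; sym; trans; cong; cong₂)
open Relation.Binary.PropositionalEquality.≡-Reasoning

module _ {A : Set} where

  sum-map-+ : ∀ (f g : A → ℕ) xs →
              sum (map (λ x → f x + g x) xs) ≡ sum (map f xs) + sum (map g xs)
  sum-map-+ f g []       = refl
  sum-map-+ f g (x ∷ xs) = begin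
    f x + g x + sum (map (λ x → f x + g x) xs)   ≡⟨ cong (_+_ (f x + g x)) (sum-map-+ f g xs) ⟩
    f x + g x + (sum (map f xs) + sum (map g xs)) ≡⟨ interchange (f x) (g x) _ _ ⟩
    f x + sum (map f xs) + (g x + sum (map g xs)) ∎
    where
    interchange : ∀ a b c d → a + b + (c + d) ≡ a + c + (b + d)
    interchange = solve-∀

  sum-map-concatMap : ∀ {B : Set} (f : B → ℕ) (k : A → List B) xs →
                      sum (map f (concatMap k xs)) ≡ sum (map (sum ∘ map f ∘ k) xs)
  sum-map-concatMap f k []       = refl
  sum-map-concatMap f k (x ∷ xs) = begin
    sum (map f (k x ++ concatMap k xs))              ≡⟨ cong sum (map-++ f (k x) _) ⟩
    sum (map f (k x) ++ map f (concatMap k xs))      ≡⟨ sum-++ (map f (k x)) _ ⟩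
    sum (map f (k x)) + sum (map f (concatMap k xs)) ≡⟨ cong (_+_ _) (sum-map-concatMap f k xs) ⟩
    sum (map f (k x)) + sum (map (sum ∘ map f ∘ k) xs) ∎

  sum-map-filterᵇ : ∀ (p : A → Bool) (f : A → ℕ) xs →
                    sum (map f (filterᵇ p xs)) ≡ sum (map (λ x → if p x then f x else 0) xs)
  sum-map-filterᵇ p f []       = refl
  sum-map-filterᵇ p f (x ∷ xs) with p x
  ... | true  = cong (_+_ (f x)) (sum-map-filterᵇ p f xs)
  ... | false = sum-map-filterᵇ p f xs

onPaths : ℕ → (List Step → ℕ) → List Step → ℕ
onPaths h g w = if validFrom h w then g w else 0

pathSum : ℕ → ℕ → (List Step → ℕ) → ℕ
pathSum h n g = sum (map (onPaths h g) (words n))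

pathSum-cong : ∀ h n {f g : List Step → ℕ} → (∀ w → f w ≡ g w) → pathSum h n f ≡ pathSum h n g
pathSum-cong h n f≗g = cong sum (map-cong (λ w → cong (if validFrom h w then_else 0) (f≗g w)) (words n))

pathSum-+ : ∀ h n (f g : List Step → ℕ) →
            pathSum h n (λ w → f w + g w) ≡ pathSum h n f + pathSum h n g
pathSum-+ h n f g = trans (cong sum (map-cong onPaths-+ (words n))) (sum-map-+ _ _ (words n))
  where
  onPaths-+ : ∀ w → onPaths h (λ w → f w + g w) w ≡ onPaths h f w + onPaths h g w
  onPaths-+ w with validFrom h w
  ... | true  = refl
  ... | false = refl

nonUp : ℕ → Step
nonUp zero    = H
nonUp (suc h) = D

onPaths-nonUp : ∀ h g w →
  onPaths h g (D ∷ w) + (onPaths h g (H ∷ w) + 0) ≡ onPaths (pred h) (g ∘ (nonUp h ∷_)) w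
onPaths-nonUp zero    g w = +-identityʳ _
onPaths-nonUp (suc h) g w = +-identityʳ _

pathSum-suc : ∀ h n g →
  pathSum h (suc n) g ≡ pathSum (suc h) n (g ∘ (U ∷_)) + pathSum (pred h) n (g ∘ (nonUp h ∷_))
pathSum-suc h n g = begin
  pathSum h (suc n) g
    ≡⟨ sum-map-concatMap _ _ (words n) ⟩
  sum (map (λ w → onPaths h g (U ∷ w) + (onPaths h g (D ∷ w) + (onPaths h g (H ∷ w) + 0))) (words n))
    ≡⟨ cong sum (map-cong (λ w → cong (_+_ (onPaths h g (U ∷ w))) (onPaths-nonUp h g w)) (words n)) ⟩
  sum (map (λ w → onPaths h g (U ∷ w) + onPaths (pred h) (g ∘ (nonUp h ∷_)) w) (words n))
    ≡⟨ sum-map-+ _ _ (words n) ⟩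
  pathSum (suc h) n (g ∘ (U ∷_)) + pathSum (pred h) n (g ∘ (nonUp h ∷_)) ∎

pathSum-const : ∀ h n k → pathSum h n (λ _ → k) ≡ k * 2 ^ n
pathSum-const h zero    k = trans (+-identityʳ k) (sym (*-identityʳ k))
pathSum-const h (suc n) k = begin
  pathSum h (suc n) (λ _ → k)                                 ≡⟨ pathSum-suc h n _ ⟩
  pathSum (suc h) n (λ _ → k) + pathSum (pred h) n (λ _ → k)  ≡⟨ cong₂ _+_ (pathSum-const (suc h) n k)
                                                                           (pathSum-const (pred h) n k) ⟩
  k * 2 ^ n + k * 2 ^ n                                       ≡⟨ double k (2 ^ n) ⟩
  k * 2 ^ suc n                                               ∎
  where
  double : ∀ k p → k * p + k * p ≡ k * (2 * p)
  double = solve-∀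

-- the length of the run of U's just before the remaining word: 0, 1, or at least 2
data UpRun : Set where
  none single multiple : UpRun

afterU : UpRun → UpRun
afterU none     = single
afterU single   = multiple
afterU multiple = multiple

endsOneAscent : UpRun → ℕ
endsOneAscent single = 1
endsOneAscent _      = 0

oneAscentsAfter : UpRun → List Step → ℕ
oneAscentsAfter none     w = oneAscFrom false w
oneAscentsAfter single   w = oneAscFrom false (U ∷ w)
oneAscentsAfter multiple w = oneAscFrom true w

oneAscentsAfter-[] : ∀ r → oneAscentsAfter r [] ≡ endsOneAscent r
oneAscentsAfter-[] none     = refl
oneAscentsAfter-[] single   = refl
oneAscentsAfter-[] multiple = refl

oneAscentsAfter-U : ∀ r w → oneAscentsAfter r (U ∷ w) ≡ oneAscentsAfter (afterU r) w
oneAscentsAfter-U none     w = refl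
oneAscentsAfter-U single   w = refl
oneAscentsAfter-U multiple w = refl

oneAscentsAfter-nonUp : ∀ r h w →
  oneAscentsAfter r (nonUp h ∷ w) ≡ endsOneAscent r + oneAscentsAfter none w
oneAscentsAfter-nonUp none     zero    w = refl
oneAscentsAfter-nonUp none     (suc h) w = refl
oneAscentsAfter-nonUp single   zero    w = refl
oneAscentsAfter-nonUp single   (suc h) w = refl
oneAscentsAfter-nonUp multiple zero    w = refl
oneAscentsAfter-nonUp multiple (suc h) w = refl

totalOneAscents : UpRun → ℕ → ℕ
totalOneAscents r zero    = endsOneAscent r
totalOneAscents r (suc n) = totalOneAscents (afterU r) n + (endsOneAscent r * 2 ^ n + totalOneAscents none n)

pathSum-oneAscentsAfter : ∀ h n r → pathSum h n (oneAscentsAfter r) ≡ totalOneAscents r n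
pathSum-oneAscentsAfter h zero    r = trans (+-identityʳ _) (oneAscentsAfter-[] r)
pathSum-oneAscentsAfter h (suc n) r = begin
  pathSum h (suc n) (oneAscentsAfter r)
    ≡⟨ pathSum-suc h n _ ⟩
  pathSum (suc h) n (oneAscentsAfter r ∘ (U ∷_)) + pathSum (pred h) n (oneAscentsAfter r ∘ (nonUp h ∷_))
    ≡⟨ cong₂ _+_ (pathSum-cong (suc h) n (oneAscentsAfter-U r))
                 (pathSum-cong (pred h) n (oneAscentsAfter-nonUp r h)) ⟩
  pathSum (suc h) n (oneAscentsAfter (afterU r))
    + pathSum (pred h) n (λ w → endsOneAscent r + oneAscentsAfter none w)
    ≡⟨ cong (_+_ _) (pathSum-+ (pred h) n _ _) ⟩
  pathSum (suc h) n (oneAscentsAfter (afterU r))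
    + (pathSum (pred h) n (λ _ → endsOneAscent r) + pathSum (pred h) n (oneAscentsAfter none))
    ≡⟨ cong₂ _+_ (pathSum-oneAscentsAfter (suc h) n (afterU r))
                 (cong₂ _+_ (pathSum-const (pred h) n (endsOneAscent r))
                            (pathSum-oneAscentsAfter (pred h) n none)) ⟩
  totalOneAscents r (suc n) ∎

B≡totalOneAscents : ∀ n → B n ≡ totalOneAscents none n
B≡totalOneAscents n = trans (sum-map-filterᵇ valid oneAscents (words n)) (pathSum-oneAscentsAfter 0 n none)

offset : UpRun → ℕ
offset none     = 4
offset single   = 6
offset multiple = 2

offset-afterU : ∀ r → offset (afterU r) + 8 * endsOneAscent r + 2 ≡ 2 * offset r
offset-afterU none     = refl
offset-afterU single   = refl
offset-afterU multiple = refl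

totalOneAscents-closedForm : ∀ m r → 2 * totalOneAscents r (2 + m) ≡ (m + offset r) * 2 ^ m
totalOneAscents-closedForm zero    none     = refl
totalOneAscents-closedForm zero    single   = refl
totalOneAscents-closedForm zero    multiple = refl
totalOneAscents-closedForm (suc m) r        = begin
  2 * (totalOneAscents (afterU r) (2 + m) + (endsOneAscent r * 2 ^ (2 + m) + totalOneAscents none (2 + m)))
    ≡⟨ distribute (totalOneAscents (afterU r) (2 + m)) (endsOneAscent r) p (totalOneAscents none (2 + m)) ⟩
  2 * totalOneAscents (afterU r) (2 + m) + 8 * endsOneAscent r * p + 2 * totalOneAscents none (2 + m)
    ≡⟨ cong₂ (λ x y → x + 8 * endsOneAscent r * p + y)
             (totalOneAscents-closedForm m (afterU r)) (totalOneAscents-closedForm m none) ⟩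
  (m + offset (afterU r)) * p + 8 * endsOneAscent r * p + (m + 4) * p
    ≡⟨ collect m (offset (afterU r)) (endsOneAscent r) p ⟩
  (2 * m + 2 + (offset (afterU r) + 8 * endsOneAscent r + 2)) * p
    ≡⟨ cong (λ c → (2 * m + 2 + c) * p) (offset-afterU r) ⟩
  (2 * m + 2 + 2 * offset r) * p
    ≡⟨ halve m (offset r) p ⟩
  (suc m + offset r) * 2 ^ suc m ∎
  where
  p = 2 ^ m
  distribute : ∀ x k p y → 2 * (x + (k * (2 * (2 * p)) + y)) ≡ 2 * x + 8 * k * p + 2 * y
  distribute = solve-∀
  collect : ∀ m a k p → (m + a) * p + 8 * k * p + (m + 4) * p ≡ (2 * m + 2 + (a + 8 * k + 2)) * p
  collect = solve-∀
  halve : ∀ m c p → (2 * m + 2 + 2 * c) * p ≡ (suc m + c) * (2 * p)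
  halve = solve-∀

B-closedForm : ∀ n → 2 ≤ n → 8 * B n ≡ (n + 2) * 2 ^ n
B-closedForm (suc (suc m)) (s≤s (s≤s z≤n)) = begin
  8 * B (2 + m)                            ≡⟨ cong (8 *_) (B≡totalOneAscents (2 + m)) ⟩
  8 * totalOneAscents none (2 + m)         ≡⟨ *-assoc 4 2 (totalOneAscents none (2 + m)) ⟩
  4 * (2 * totalOneAscents none (2 + m))   ≡⟨ cong (4 *_) (totalOneAscents-closedForm m none) ⟩
  4 * ((m + 4) * 2 ^ m)                    ≡⟨ shift m (2 ^ m) ⟩
  (2 + m + 2) * 2 ^ (2 + m)                ∎
  where
  shift : ∀ m p → 4 * ((m + 4) * p) ≡ (2 + m + 2) * (2 * (2 * p))
  shift = solve-∀

B-recurrence : ∀ m → B (4 + m) + 4 * B (2 + m) ≡ 4 * B (3 + m)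
B-recurrence m = *-cancelˡ-≡ _ _ 8 (begin
  8 * (B (4 + m) + 4 * B (2 + m))
    ≡⟨ spread (B (4 + m)) (B (2 + m)) ⟩
  8 * B (4 + m) + 4 * (8 * B (2 + m))
    ≡⟨ cong₂ (λ x y → x + 4 * y) (B-closedForm (4 + m) (m≤m+n 2 (2 + m))) (B-closedForm (2 + m) (m≤m+n 2 m)) ⟩
  (4 + m + 2) * 2 ^ (4 + m) + 4 * ((2 + m + 2) * 2 ^ (2 + m))
    ≡⟨ powers m (2 ^ m) ⟩
  4 * ((3 + m + 2) * 2 ^ (3 + m))
    ≡⟨ cong (4 *_) (B-closedForm (3 + m) (m≤m+n 2 (1 + m))) ⟨
  4 * (8 * B (3 + m))
    ≡⟨ swap (B (3 + m)) ⟩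
  8 * (4 * B (3 + m)) ∎)
  where
  spread : ∀ x y → 8 * (x + 4 * y) ≡ 8 * x + 4 * (8 * y)
  spread = solve-∀
  powers : ∀ m p → (4 + m + 2) * (2 * (2 * (2 * (2 * p)))) + 4 * ((2 + m + 2) * (2 * (2 * p)))
                 ≡ 4 * ((3 + m + 2) * (2 * (2 * (2 * p))))
  powers = solve-∀
  swap : ∀ x → 4 * (8 * x) ≡ 8 * (4 * x)
  swap = solve-∀

sumTo-vanishing : ∀ k (f : ℕ → ℤ.ℤ) → (∀ i → f (k + i) ≡ + 0) → ∀ j → sumTo (k + j) f ≡ sumTo k f
sumTo-vanishing k f vanish zero    = cong (λ n → sumTo n f) (+-identityʳ k)
sumTo-vanishing k f vanish (suc j) = begin
  sumTo (k + suc j) f           ≡⟨ cong (λ n → sumTo n f) (+-suc k j) ⟩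
  sumTo (k + j) f ℤ.+ f (k + j) ≡⟨ cong₂ ℤ._+_ (sumTo-vanishing k f vanish j) (vanish j) ⟩
  sumTo k f ℤ.+ + 0             ≡⟨ ℤ.+-identityʳ (sumTo k f) ⟩
  sumTo k f                     ∎

coefficient-vanishes : ∀ a b c → a + 4 * c ≡ 4 * b →
  ((+ 0 ℤ.+ + 1 ℤ.* + a) ℤ.+ -[1+ 3 ] ℤ.* + b) ℤ.+ + 4 ℤ.* + c ≡ + 0
coefficient-vanishes a b c recurrence = begin
  ((+ 0 ℤ.+ + 1 ℤ.* + a) ℤ.+ -[1+ 3 ] ℤ.* + b) ℤ.+ + 4 ℤ.* + c ≡⟨ regroup (+ a) (+ b) (+ c) ⟩
  (+ a ℤ.+ + 4 ℤ.* + c) ℤ.- + 4 ℤ.* + b                       ≡⟨ i≡j⇒i-j≡0 embedded ⟩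
  + 0                                                         ∎
  where
  regroup : ∀ x y z → ((+ 0 ℤ.+ + 1 ℤ.* x) ℤ.+ -[1+ 3 ] ℤ.* y) ℤ.+ + 4 ℤ.* z
                    ≡ (x ℤ.+ + 4 ℤ.* z) ℤ.- + 4 ℤ.* y
  regroup = ℤ-Solver.solve-∀
  embedded : + a ℤ.+ + 4 ℤ.* + c ≡ + 4 ℤ.* + b
  embedded = begin
    + a ℤ.+ + 4 ℤ.* + c ≡⟨ cong (ℤ._+_ (+ a)) (pos-* 4 c) ⟨
    + a ℤ.+ + (4 * c)   ≡⟨ pos-+ a (4 * c) ⟨
    + (a + 4 * c)       ≡⟨ cong +_ recurrence ⟩
    + (4 * b)           ≡⟨ pos-* 4 b ⟩
    + 4 ℤ.* + b         ∎

genB-rational : ∀ n →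
  (poly (+ 1 ∷ -[1+ 3 ] ∷ + 4 ∷ []) ⊛ genB) n ≡ poly (+ 0 ∷ + 1 ∷ -[1+ 1 ] ∷ + 1 ∷ []) n
genB-rational 0 = refl
genB-rational 1 = refl
genB-rational 2 = refl
genB-rational 3 = refl
genB-rational (suc (suc (suc (suc m)))) =
  trans (sumTo-vanishing 3 _ (λ _ → refl) (2 + m))
        (coefficient-vanishes (B (4 + m)) (B (3 + m)) (B (2 + m)) (B-recurrence m))

mainTheorem3 : (∀ n → (poly (+ 1 ∷ -[1+ 3 ] ∷ + 4 ∷ []) ⊛ genB) n ≡ poly (+ 0 ∷ + 1 ∷ -[1+ 1 ] ∷ + 1 ∷ []) n)
    × (B 0 ≡ 0) × (B 1 ≡ 1) × (∀ n → 2 ≤ n → 8 * B n ≡ (n + 2) * 2 ^ n)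
mainTheorem3 = genB-rational , refl , refl , B-closedForm
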